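{- A finite digraph is an $IO$-graph if and only if it is a disjoint union of lines and/or circles, i.e., isomorphic to a disjoint union of digraphs each of which is some $I_n$ ($n\ge1$) or some $O_n$ ($n\ge3$).
   Context: Digraphs are pairs $(V,E)$, $V$ nonempty finite, $E\subseteq V^2$ (loops allowed). $E_n$ is the digraph on $n$ vertices with no edges. $I_n$ ($n\ge1$, "line") has vertices $v_1,\dots,v_n$ and edges $(v_1,v_2),\dots,(v_{n-1},v_n)$; $O_n$ ($n\ge 3$, "circle") has additionally the edge $(v_n,v_1)$. $\dot\cup$ denotes disjoint union. A substructure is an induced subdigraph (up to isomorphism). A digraph is an $IO$-graph if its only one-element substructure is $E_1$, each of its two-element substructures is $E_2$ or $I_2$, and each of its three-element substructures is one of $E_3$, $I_2\dot\cup E_1$, $I_3$, $O_3$. -}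

module Defs where

open import Data.Nat using (ℕ; zero; suc; _+_; _∸_; _≤_; _≡ᵇ_)
open import Data.Fin using (Fin; toℕ; splitAt)
open import Data.Bool using (Bool; true; false; _∧_; _∨_)
open import Data.Sum using (_⊎_; inj₁; inj₂)
open import Data.Product using (Σ; _×_; ∃)
open import Data.List using (List; []; _∷_; foldr; map)
open import Function.Bundles using (_↔_; Inverse)
open import Function.Definitions using (Injective)
open import Relation.Binary.PropositionalEquality using (_≡_)

-- A finite digraph: vertex set Fin size, edge relation (decidable, as Bool);
-- loops allowed.  Nonemptiness (size ≥ 1) is imposed separately.
record Digraph : Set where
  constructor mkDigraph
  field
    size : ℕ
    edge : Fin size → Fin size → Bool
open Digraph public

_≅_ : Digraph → Digraph → Set
G ≅ H = Σ (Fin (size G) ↔ Fin (size H)) λ σ →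
  ∀ i j → edge G i j ≡ edge H (Inverse.to σ i) (Inverse.to σ j)

Eg : ℕ → Digraph
Eg n = mkDigraph n (λ _ _ → false)

Ig : ℕ → Digraph
Ig n = mkDigraph n (λ i j → toℕ j ≡ᵇ suc (toℕ i))

Og : ℕ → Digraph
Og n = mkDigraph n (λ i j → (toℕ j ≡ᵇ suc (toℕ i)) ∨ ((toℕ i ≡ᵇ (n ∸ 1)) ∧ (toℕ j ≡ᵇ 0)))

_⊍_ : Digraph → Digraph → Digraph
G ⊍ H = mkDigraph (size G + size H) e
  where
  e : Fin (size G + size H) → Fin (size G + size H) → Bool
  e i j with splitAt (size G) i | splitAt (size G) j
  ... | inj₁ a | inj₁ b = edge G a b
  ... | inj₂ a | inj₂ b = edge H a b
  ... | inj₁ _ | inj₂ _ = false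
  ... | inj₂ _ | inj₁ _ = false

induced : (G : Digraph) {k : ℕ} (f : Fin k → Fin (size G)) → Digraph
induced G {k} f = mkDigraph k (λ i j → edge G (f i) (f j))

AllSubstructures : (G : Digraph) (k : ℕ) (P : Digraph → Set) → Set
AllSubstructures G k P = (f : Fin k → Fin (size G)) → Injective _≡_ _≡_ f → P (induced G f)

IsIOGraph : Digraph → Set
IsIOGraph G =
  AllSubstructures G 1 (λ S → S ≅ Eg 1) ×
  AllSubstructures G 2 (λ S → (S ≅ Eg 2) ⊎ (S ≅ Ig 2)) ×
  AllSubstructures G 3 (λ S → (S ≅ Eg 3) ⊎ (S ≅ (Ig 2 ⊍ Eg 1)) ⊎ (S ≅ Ig 3) ⊎ (S ≅ Og 3))

data Component : Set where
  line   : (n : ℕ) → 1 ≤ n → Component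
  circle : (n : ℕ) → 3 ≤ n → Component

component : Component → Digraph
component (line n _)   = Ig n
component (circle n _) = Og n

-- Disjoint union of a nonempty list of components  c ∷ cs.
⋃ : Component → List Component → Digraph
⋃ c []        = component c
⋃ c (d ∷ cs) = component c ⊍ ⋃ d cs

IsLinesAndCircles : Digraph → Set
IsLinesAndCircles G = ∃ λ c → ∃ λ cs → G ≅ ⋃ c cs

module Submission where

-- Both notions are compared with a local one: a digraph is *path-like* if it has
-- no loops, no 2-cycles, and in- and out-degree at most one.
--
-- 1. Path-likeness is inherited by induced subdigraphs, transported along
--    isomorphisms, and holds for lines, circles (with ≥ 3 vertices) and disjoint
--    unions; so disjoint unions of lines and circles are path-like.
-- 2. IO-graphs are exactly the path-like digraphs.  The forbidden patterns on one,
--    two and three vertices are precisely loops, 2-cycles and vertices of degree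
--    two; conversely, the path-like digraphs on at most three vertices are the
--    allowed substructures, which is checked exhaustively over all edge tables.
-- 3. A nonempty path-like digraph is a disjoint union of lines and circles.  Walking
--    along the unique out-edges, a source leads to a line ending in a sink, and when
--    there is no source every walk returns to its start, tracing out a circle; the
--    components found so far are kept as a closed embedding of their union into G,
--    which is extended until it is onto.

open import Defs
open import Data.Nat using (ℕ; zero; suc; _+_; _*_; _∸_; _≤_; _<_; z≤n; s≤s; z<s; s<s)
open import Data.Nat.Properties
  using (≡ᵇ⇒≡; ≡⇒≡ᵇ; suc-injective; m≢1+n+m; <-irrefl; <-cmp; ≤-trans; <-≤-trans; ≤-pred; n≤1+n;
         n<1+n; m≤m+n; ≤-reflexive; <⇒≤; ≤-refl; m≤n⇒m<n∨m≡n; +-assoc; +-monoˡ-≤; +-identityʳ;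
         <⇒≱; m<n+m; module ≤-Reasoning; m≤n+m; +-suc; m≤n⇒∃[o]m+o≡n)
open import Data.Fin using (Fin; zero; suc; toℕ; fromℕ<; splitAt; join; _↑ˡ_; _↑ʳ_; combine; remQuot)
open import Data.Fin.Properties
  using (toℕ-injective; toℕ<n; toℕ-fromℕ<; toℕ-inject; join-splitAt; splitAt-↑ˡ; splitAt-↑ʳ; all?; any?; remQuot-combine;
         pigeonhole; injective⇒≤; ¬∀⟶∃¬; ¬∀⟶∃¬-smallest)
  renaming (_≟_ to _≟ᶠ_)
open import Data.Fin.Permutation using (Permutation′; transpose; _∘ₚ_; _⟨$⟩ʳ_) renaming (id to idₚ)
open import Data.Bool using (Bool; true; false)
open import Data.Bool.Properties using (T-≡; T-∨; T-∧; ⇔→≡; ¬-not) renaming (_≟_ to _≟ᵇ_)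
open import Data.Empty using (⊥; ⊥-elim)
open import Data.Unit using (⊤; tt)
open import Data.List using (List; []; _∷_)
open import Data.List.Relation.Unary.All using (All; []; _∷_)
open import Data.List.Relation.Unary.Any using (Any; satisfied) renaming (any? to anyᴸ?)
open import Data.Product using (∃; _×_; _,_; proj₁; proj₂; uncurry)
open import Data.Sum using (_⊎_; inj₁; inj₂; [_,_]′)
open import Data.Vec using (Vec; []; _∷_; lookup; tabulate)
open import Data.Vec.Properties using (lookup∘tabulate)
open import Function.Base using (_∘_)
open import Function.Bundles using (_⇔_; mk⇔; mk↔ₛ′; Inverse; Injection; Equivalence)
open import Function.Definitions using (Injective)
open import Function.Properties.Inverse using (↔-refl; ↔-trans; ↔⇒↣)
open import Function.Construct.Composition using (_⇔-∘_)
open import Function.Construct.Symmetry using (⇔-sym)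
open import Relation.Nullary using (¬_; Dec; yes; no; ¬?)
open import Relation.Nullary.Decidable using (map′; _×-dec_; _⊎-dec_; _→-dec_; toWitness; decidable-stable)
open import Relation.Unary using (Decidable)
open import Relation.Binary using (tri<; tri≈; tri>)
open import Relation.Binary.PropositionalEquality

Adj : (G : Digraph) → Fin (size G) → Fin (size G) → Set
Adj G x y = edge G x y ≡ true

record PathLike (G : Digraph) : Set where
  field
    loopless   : ∀ x → ¬ Adj G x x
    asymmetric : ∀ {x y} → Adj G x y → ¬ Adj G y x
    out-unique : ∀ {x y z} → Adj G x y → Adj G x z → y ≡ z
    in-unique  : ∀ {x y z} → Adj G y x → Adj G z x → y ≡ z

≅-trans : ∀ {G H K} → G ≅ H → H ≅ K → G ≅ K
≅-trans (σ , σ-edges) (τ , τ-edges) =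
  ↔-trans σ τ , λ i j → trans (σ-edges i j) (τ-edges _ _)

pathLike-≅ : ∀ {G H} → G ≅ H → PathLike H → PathLike G
pathLike-≅ {G} {H} (σ , edges) P = record
  { loopless   = λ x e → loopless (to x) (adj e)
  ; asymmetric = λ e f → asymmetric (adj e) (adj f)
  ; out-unique = λ e f → to-injective (out-unique (adj e) (adj f))
  ; in-unique  = λ e f → to-injective (in-unique (adj e) (adj f))
  }
  where
  open PathLike P
  open Inverse σ using (to)
  to-injective : Injective _≡_ _≡_ to
  to-injective = Injection.injective (↔⇒↣ σ)
  adj : ∀ {x y} → Adj G x y → Adj H (to x) (to y)
  adj {x} {y} e = trans (sym (edges x y)) e

pathLike-induced : ∀ {G k} {f : Fin k → Fin (size G)} → Injective _≡_ _≡_ f →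
                   PathLike G → PathLike (induced G f)
pathLike-induced f-injective P = record
  { loopless   = λ x → loopless _
  ; asymmetric = asymmetric
  ; out-unique = λ e f → f-injective (out-unique e f)
  ; in-unique  = λ e f → f-injective (in-unique e f)
  }
  where open PathLike P

-- The digraph with all edges reversed; it lets us walk backwards.
reverse : Digraph → Digraph
reverse G = mkDigraph (size G) (λ x y → edge G y x)

pathLike-reverse : ∀ {G} → PathLike G → PathLike (reverse G)
pathLike-reverse P = record
  { loopless = loopless ; asymmetric = asymmetric ; out-unique = in-unique ; in-unique = out-unique }
  where open PathLike P

pathLike-Eg : ∀ n → PathLike (Eg n)
pathLike-Eg n = record
  { loopless = λ _ () ; asymmetric = λ () ; out-unique = λ () ; in-unique = λ () }

Ig-adj : ∀ {n} {a b : Fin n} → Adj (Ig n) a b ⇔ toℕ b ≡ suc (toℕ a)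
Ig-adj = mk⇔ (λ e → ≡ᵇ⇒≡ _ _ (Equivalence.from T-≡ e)) (λ e → Equivalence.to T-≡ (≡⇒≡ᵇ _ _ e))

pathLike-Ig : ∀ n → PathLike (Ig n)
pathLike-Ig n = record
  { loopless   = λ x e → m≢1+n+m (toℕ x) {0} (step x x e)
  ; asymmetric = λ {x} {y} e f → m≢1+n+m (toℕ x) {1} (trans (step y x f) (cong suc (step x y e)))
  ; out-unique = λ {x} {y} {z} e f → toℕ-injective (trans (step x y e) (sym (step x z f)))
  ; in-unique  = λ {x} {y} {z} e f →
      toℕ-injective (suc-injective (trans (sym (step y x e)) (step z x f)))
  }
  where
  step : ∀ a b → Adj (Ig n) a b → toℕ b ≡ suc (toℕ a)
  step a b = Equivalence.to (Ig-adj {n} {a} {b})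

CircleStep : ℕ → ℕ → ℕ → Set
CircleStep n a b = b ≡ suc a ⊎ (a ≡ n ∸ 1 × b ≡ 0)

Og-adj : ∀ {n} {a b : Fin n} → Adj (Og n) a b ⇔ CircleStep n (toℕ a) (toℕ b)
Og-adj = mk⇔ to from
  where
  to : ∀ {n} {a b : Fin n} → Adj (Og n) a b → CircleStep n (toℕ a) (toℕ b)
  to e with Equivalence.to T-∨ (Equivalence.from T-≡ e)
  ... | inj₁ next = inj₁ (≡ᵇ⇒≡ _ _ next)
  ... | inj₂ wrap with Equivalence.to T-∧ wrap
  ...   | last , first = inj₂ (≡ᵇ⇒≡ _ _ last , ≡ᵇ⇒≡ _ _ first)
  from : ∀ {n} {a b : Fin n} → CircleStep n (toℕ a) (toℕ b) → Adj (Og n) a b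
  from (inj₁ next) = Equivalence.to T-≡ (Equivalence.from T-∨ (inj₁ (≡⇒≡ᵇ _ _ next)))
  from (inj₂ (last , first)) = Equivalence.to T-≡
    (Equivalence.from T-∨ (inj₂ (Equivalence.from T-∧ (≡⇒≡ᵇ _ _ last , ≡⇒≡ᵇ _ _ first))))

-- A circle needs at least three vertices to have neither loops nor 2-cycles.
pathLike-Og : ∀ {n} → 3 ≤ n → PathLike (Og n)
pathLike-Og {n} (s≤s (s≤s (s≤s _))) = record
  { loopless   = λ x e → no-loop (step x x e)
  ; asymmetric = λ {x} {y} e f → no-2-cycle (step x y e) (step y x f)
  ; out-unique = λ {x} {y} {z} e f →
      toℕ-injective (same-target (step x y e) (step x z f) (toℕ<n y) (toℕ<n z))
  ; in-unique  = λ {x} {y} {z} e f → toℕ-injective (same-source (step y x e) (step z x f))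
  }
  where
  step : ∀ a b → Adj (Og n) a b → CircleStep n (toℕ a) (toℕ b)
  step a b = Equivalence.to (Og-adj {n} {a} {b})
  no-loop : ∀ {a} → ¬ CircleStep n a a
  no-loop (inj₁ ())
  no-loop (inj₂ (refl , ()))
  no-2-cycle : ∀ {a b} → CircleStep n a b → ¬ CircleStep n b a
  no-2-cycle (inj₁ refl) (inj₁ ())
  no-2-cycle (inj₁ refl) (inj₂ (() , refl))
  no-2-cycle (inj₂ (refl , refl)) (inj₁ ())
  no-2-cycle (inj₂ (refl , refl)) (inj₂ (() , _))
  same-target : ∀ {a b c} → CircleStep n a b → CircleStep n a c → b < n → c < n → b ≡ c
  same-target (inj₁ refl) (inj₁ refl) _ _ = refl
  same-target (inj₁ refl) (inj₂ (refl , refl)) b<n _ = ⊥-elim (<-irrefl refl b<n)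
  same-target (inj₂ (refl , refl)) (inj₁ refl) _ c<n = ⊥-elim (<-irrefl refl c<n)
  same-target (inj₂ (_ , refl)) (inj₂ (_ , refl)) _ _ = refl
  same-source : ∀ {a b c} → CircleStep n b a → CircleStep n c a → b ≡ c
  same-source (inj₁ refl) (inj₁ refl) = refl
  same-source (inj₁ refl) (inj₂ (_ , ()))
  same-source (inj₂ (_ , ())) (inj₁ refl)
  same-source (inj₂ (refl , _)) (inj₂ (refl , _)) = refl

splitAt-injective : ∀ m {n} {i j : Fin (m + n)} → splitAt m i ≡ splitAt m j → i ≡ j
splitAt-injective m {n} {i} {j} eq =
  trans (sym (join-splitAt m n i)) (trans (cong (join m n) eq) (join-splitAt m n j))

-- A disjoint union of path-like digraphs is path-like: every edge stays in one part.
pathLike-⊍ : ∀ {A B} → PathLike A → PathLike B → PathLike (A ⊍ B)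
pathLike-⊍ {A} {B} PA PB = record
  { loopless = loopless ; asymmetric = asymmetric ; out-unique = out-unique ; in-unique = in-unique }
  where
  m : ℕ
  m = size A
  module PA = PathLike PA
  module PB = PathLike PB
  loopless : ∀ x → ¬ Adj (A ⊍ B) x x
  loopless x with splitAt m x
  ... | inj₁ a = PA.loopless a
  ... | inj₂ b = PB.loopless b
  asymmetric : ∀ {x y} → Adj (A ⊍ B) x y → ¬ Adj (A ⊍ B) y x
  asymmetric {x} {y} with splitAt m x | splitAt m y
  ... | inj₁ a | inj₁ b = PA.asymmetric
  ... | inj₂ a | inj₂ b = PB.asymmetric
  ... | inj₁ a | inj₂ b = λ ()
  ... | inj₂ a | inj₁ b = λ ()
  out-unique : ∀ {x y z} → Adj (A ⊍ B) x y → Adj (A ⊍ B) x z → y ≡ z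
  out-unique {x} {y} {z} e f with splitAt m x | splitAt m y in ey | splitAt m z in ez
  ... | inj₁ a | inj₁ b | inj₁ c =
      splitAt-injective m (trans ey (trans (cong inj₁ (PA.out-unique e f)) (sym ez)))
  ... | inj₂ a | inj₂ b | inj₂ c =
      splitAt-injective m (trans ey (trans (cong inj₂ (PB.out-unique e f)) (sym ez)))
  ... | inj₁ _ | inj₂ _ | _      with () ← e
  ... | inj₂ _ | inj₁ _ | _      with () ← e
  ... | inj₁ _ | inj₁ _ | inj₂ _ with () ← f
  ... | inj₂ _ | inj₂ _ | inj₁ _ with () ← f
  in-unique : ∀ {x y z} → Adj (A ⊍ B) y x → Adj (A ⊍ B) z x → y ≡ z
  in-unique {x} {y} {z} e f with splitAt m x | splitAt m y in ey | splitAt m z in ez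
  ... | inj₁ a | inj₁ b | inj₁ c =
      splitAt-injective m (trans ey (trans (cong inj₁ (PA.in-unique e f)) (sym ez)))
  ... | inj₂ a | inj₂ b | inj₂ c =
      splitAt-injective m (trans ey (trans (cong inj₂ (PB.in-unique e f)) (sym ez)))
  ... | inj₁ _ | inj₂ _ | _      with () ← e
  ... | inj₂ _ | inj₁ _ | _      with () ← e
  ... | inj₁ _ | inj₁ _ | inj₂ _ with () ← f
  ... | inj₂ _ | inj₂ _ | inj₁ _ with () ← f

pathLike-component : ∀ c → PathLike (component c)
pathLike-component (line n _)     = pathLike-Ig n
pathLike-component (circle n 3≤n) = pathLike-Og 3≤n

pathLike-⋃ : ∀ c cs → PathLike (⋃ c cs)
pathLike-⋃ c []       = pathLike-component c
pathLike-⋃ c (d ∷ cs) = pathLike-⊍ (pathLike-component c) (pathLike-⋃ d cs)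

linesAndCircles⇒pathLike : ∀ {G} → IsLinesAndCircles G → PathLike G
linesAndCircles⇒pathLike (c , cs , σ) = pathLike-≅ σ (pathLike-⋃ c cs)

Table : ℕ → Set
Table k = Fin k → Fin k → Bool

≅-pointwise : ∀ {n} {e e′ : Fin n → Fin n → Bool} → (∀ i j → e i j ≡ e′ i j) →
              mkDigraph n e ≅ mkDigraph n e′
≅-pointwise agree = ↔-refl , agree

pathLike? : (G : Digraph) → Dec (PathLike G)
pathLike? G = map′ fromConditions toConditions
  (all? (λ x → ¬? (adj? x x))
   ×-dec all? (λ x → all? λ y → adj? x y →-dec ¬? (adj? y x))
   ×-dec all? (λ x → all? λ y → all? λ z → adj? x y →-dec (adj? x z →-dec (y ≟ᶠ z)))
   ×-dec all? (λ x → all? λ y → all? λ z → adj? y x →-dec (adj? z x →-dec (y ≟ᶠ z))))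
  where
  adj? : ∀ x y → Dec (Adj G x y)
  adj? x y = edge G x y ≟ᵇ true
  Conditions : Set
  Conditions = (∀ x → ¬ Adj G x x)
             × (∀ x y → Adj G x y → ¬ Adj G y x)
             × (∀ x y z → Adj G x y → Adj G x z → y ≡ z)
             × (∀ x y z → Adj G y x → Adj G z x → y ≡ z)
  fromConditions : Conditions → PathLike G
  fromConditions (l , a , o , i) = record
    { loopless = l ; asymmetric = a _ _ ; out-unique = o _ _ _ ; in-unique = i _ _ _ }
  toConditions : PathLike G → Conditions
  toConditions P = loopless , (λ _ _ → asymmetric) , (λ _ _ _ → out-unique) , (λ _ _ _ → in-unique)
    where open PathLike P

-- "S is isomorphic to one of the digraphs with the listed tables", as a
-- right-nested sum; this is the shape of the conditions defining IO-graphs.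
OneOf : ∀ {k} → List (Table k) → Digraph → Set
OneOf []           S = ⊥
OneOf (t ∷ [])     S = S ≅ mkDigraph _ t
OneOf (t ∷ u ∷ ts) S = (S ≅ mkDigraph _ t) ⊎ OneOf (u ∷ ts) S

oneOf-≅ : ∀ {k} (ts : List (Table k)) {S S′} → S ≅ S′ → OneOf ts S′ → OneOf ts S
oneOf-≅ (t ∷ [])     σ τ        = ≅-trans {K = mkDigraph _ t} σ τ
oneOf-≅ (t ∷ u ∷ ts) σ (inj₁ τ) = inj₁ (≅-trans {K = mkDigraph _ t} σ τ)
oneOf-≅ (t ∷ u ∷ ts) σ (inj₂ τ) = inj₂ (oneOf-≅ (u ∷ ts) σ τ)

oneOf-pathLike : ∀ {k} {ts : List (Table k)} {S} →
                 All (λ t → PathLike (mkDigraph k t)) ts → OneOf ts S → PathLike S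
oneOf-pathLike {ts = t ∷ []}     (P ∷ _)  σ        = pathLike-≅ σ P
oneOf-pathLike {ts = t ∷ u ∷ ts} (P ∷ _)  (inj₁ σ) = pathLike-≅ σ P
oneOf-pathLike {ts = t ∷ u ∷ ts} (_ ∷ Ps) (inj₂ σ) = oneOf-pathLike Ps σ

Agrees : ∀ {k} → Table k → Table k → Permutation′ k → Set
Agrees s t π = ∀ i j → s i j ≡ t (π ⟨$⟩ʳ i) (π ⟨$⟩ʳ j)

agrees? : ∀ {k} (s t : Table k) → Decidable (Agrees s t)
agrees? s t π = all? λ i → all? λ j → s i j ≟ᵇ t (π ⟨$⟩ʳ i) (π ⟨$⟩ʳ j)

-- A decidable refinement of OneOf: the isomorphism is one of the permutations πs.
Matches : ∀ {k} → List (Permutation′ k) → List (Table k) → Table k → Set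
Matches πs []       s = ⊥
Matches πs (t ∷ ts) s = Any (Agrees s t) πs ⊎ Matches πs ts s

matches? : ∀ {k} πs (ts : List (Table k)) s → Dec (Matches πs ts s)
matches? πs []       s = no λ ()
matches? πs (t ∷ ts) s = anyᴸ? (agrees? s t) πs ⊎-dec matches? πs ts s

matches⇒oneOf : ∀ {k} {πs} (ts : List (Table k)) {s} → Matches πs ts s → OneOf ts (mkDigraph k s)
matches⇒oneOf (t ∷ [])     (inj₁ π) = satisfied π
matches⇒oneOf (t ∷ u ∷ ts) (inj₁ π) = inj₁ (satisfied π)
matches⇒oneOf (t ∷ u ∷ ts) (inj₂ m) = inj₂ (matches⇒oneOf (u ∷ ts) m)

fromEntries : ∀ {k} → Vec Bool (k * k) → Table k
fromEntries v i j = lookup v (combine i j)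

entries : ∀ {k} → Table k → Vec Bool (k * k)
entries {k} t = tabulate (λ c → uncurry t (remQuot k c))

fromEntries-entries : ∀ {k} (t : Table k) i j → fromEntries (entries t) i j ≡ t i j
fromEntries-entries t i j =
  trans (lookup∘tabulate _ (combine i j)) (cong (uncurry t) (remQuot-combine i j))

∀-Vec? : ∀ {m} {P : Vec Bool m → Set} → Decidable P → Dec (∀ v → P v)
∀-Vec? {zero}      P? = map′ (λ p → λ { [] → p }) (λ p → p []) (P? [])
∀-Vec? {suc m} {P} P? =
  map′ byHead (λ p → (λ v → p (true ∷ v)) , (λ v → p (false ∷ v)))
       (∀-Vec? (λ v → P? (true ∷ v)) ×-dec ∀-Vec? (λ v → P? (false ∷ v)))
  where
  byHead : (∀ v → P (true ∷ v)) × (∀ v → P (false ∷ v)) → ∀ v → P v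
  byHead (p , _) (true  ∷ v) = p v
  byHead (_ , p) (false ∷ v) = p v

Exhaustive : ∀ {k} → List (Permutation′ k) → List (Table k) → Set
Exhaustive {k} πs ts = ∀ v → PathLike (mkDigraph k (fromEntries v)) → Matches πs ts (fromEntries v)

classify : ∀ {k} (πs : List (Permutation′ k)) (ts : List (Table k)) → Exhaustive πs ts →
           ∀ s → PathLike (mkDigraph k s) → OneOf ts (mkDigraph k s)
classify πs ts exhaustive s P =
  oneOf-≅ ts (≅-pointwise (λ i j → sym (fromEntries-entries s i j)))
    (matches⇒oneOf ts (exhaustive (entries s)
      (pathLike-≅ (≅-pointwise (fromEntries-entries s)) P)))

-- Exhaustiveness is decided by running through all 2^(k*k) tables.
exhaustive? : ∀ {k} (πs : List (Permutation′ k)) (ts : List (Table k)) → Dec (Exhaustive πs ts)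
exhaustive? πs ts = ∀-Vec? (λ v → pathLike? _ →-dec matches? πs ts (fromEntries v))

patterns₁ : List (Table 1)
patterns₁ = edge (Eg 1) ∷ []

patterns₂ : List (Table 2)
patterns₂ = edge (Eg 2) ∷ edge (Ig 2) ∷ []

patterns₃ : List (Table 3)
patterns₃ = edge (Eg 3) ∷ edge (Ig 2 ⊍ Eg 1) ∷ edge (Ig 3) ∷ edge (Og 3) ∷ []

permutations₃ : List (Permutation′ 3)
permutations₃ = idₚ ∷ t₀₁ ∷ t₀₂ ∷ t₁₂ ∷ (t₀₁ ∘ₚ t₁₂) ∷ (t₁₂ ∘ₚ t₀₁) ∷ []
  where
  t₀₁ t₀₂ t₁₂ : Permutation′ 3
  t₀₁ = transpose zero (suc zero)
  t₀₂ = transpose zero (suc (suc zero))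
  t₁₂ = transpose (suc zero) (suc (suc zero))

pathLike₁ : ∀ s → PathLike (mkDigraph 1 s) → OneOf patterns₁ (mkDigraph 1 s)
pathLike₁ = classify (idₚ ∷ []) patterns₁ (toWitness {a? = exhaustive? (idₚ ∷ []) patterns₁} _)

pathLike₂ : ∀ s → PathLike (mkDigraph 2 s) → OneOf patterns₂ (mkDigraph 2 s)
pathLike₂ = classify πs patterns₂ (toWitness {a? = exhaustive? πs patterns₂} _)
  where
  πs : List (Permutation′ 2)
  πs = idₚ ∷ transpose zero (suc zero) ∷ []

pathLike₃ : ∀ s → PathLike (mkDigraph 3 s) → OneOf patterns₃ (mkDigraph 3 s)
pathLike₃ = classify permutations₃ patterns₃ (toWitness {a? = exhaustive? permutations₃ patterns₃} _)

patterns₁-pathLike : All (λ t → PathLike (mkDigraph 1 t)) patterns₁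
patterns₁-pathLike = pathLike-Eg 1 ∷ []

patterns₂-pathLike : All (λ t → PathLike (mkDigraph 2 t)) patterns₂
patterns₂-pathLike = pathLike-Eg 2 ∷ pathLike-Ig 2 ∷ []

patterns₃-pathLike : All (λ t → PathLike (mkDigraph 3 t)) patterns₃
patterns₃-pathLike = pathLike-Eg 3 ∷ pathLike-⊍ (pathLike-Ig 2) (pathLike-Eg 1) ∷ pathLike-Ig 3
                   ∷ pathLike-Og (s≤s (s≤s (s≤s z≤n))) ∷ []

-- Path-like digraphs are IO-graphs: their small substructures are path-like.
pathLike⇒IO : ∀ {G} → PathLike G → IsIOGraph G
pathLike⇒IO P =
    (λ f f-injective → pathLike₁ _ (pathLike-induced f-injective P))
  , (λ f f-injective → pathLike₂ _ (pathLike-induced f-injective P))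
  , (λ f f-injective → pathLike₃ _ (pathLike-induced f-injective P))

pair : ∀ {A : Set} → A → A → Fin 2 → A
pair x y zero    = x
pair x y (suc _) = y

triple : ∀ {A : Set} → A → A → A → Fin 3 → A
triple x y z zero             = x
triple x y z (suc zero)       = y
triple x y z (suc (suc zero)) = z

pair-injective : ∀ {A : Set} {x y : A} → x ≢ y → Injective _≡_ _≡_ (pair x y)
pair-injective x≢y {zero}     {zero}     _  = refl
pair-injective x≢y {suc zero} {suc zero} _  = refl
pair-injective x≢y {zero}     {suc zero} eq = ⊥-elim (x≢y eq)
pair-injective x≢y {suc zero} {zero}     eq = ⊥-elim (x≢y (sym eq))

triple-injective : ∀ {A : Set} {x y z : A} → x ≢ y → x ≢ z → y ≢ z →
                   Injective _≡_ _≡_ (triple x y z)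
triple-injective x≢y x≢z y≢z {i} {j} eq with i ≟ᶠ j
... | yes i≡j = i≡j
... | no  i≢j = ⊥-elim (distinct i j i≢j eq)
  where
  distinct : ∀ i j → i ≢ j → triple _ _ _ i ≢ triple _ _ _ j
  distinct zero             zero             i≢j = ⊥-elim (i≢j refl)
  distinct zero             (suc zero)       _   = x≢y
  distinct zero             (suc (suc zero)) _   = x≢z
  distinct (suc zero)       zero             _   = x≢y ∘ sym
  distinct (suc zero)       (suc zero)       i≢j = ⊥-elim (i≢j refl)
  distinct (suc zero)       (suc (suc zero)) _   = y≢z
  distinct (suc (suc zero)) zero             _   = x≢z ∘ sym
  distinct (suc (suc zero)) (suc zero)       _   = y≢z ∘ sym
  distinct (suc (suc zero)) (suc (suc zero)) i≢j = ⊥-elim (i≢j refl)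

-- IO-graphs are path-like: loops are excluded by the one-element substructures,
-- 2-cycles by the two-element ones, and a vertex with two out- or in-neighbours
-- would give a forbidden three-element substructure.
IO⇒pathLike : ∀ {G} → IsIOGraph G → PathLike G
IO⇒pathLike {G} (io₁ , io₂ , io₃) = record
  { loopless = loopless ; asymmetric = asymmetric ; out-unique = out-unique ; in-unique = in-unique }
  where
  loopless : ∀ x → ¬ Adj G x x
  loopless x = PathLike.loopless
    (oneOf-pathLike patterns₁-pathLike (io₁ (λ _ → x) λ { {zero} {zero} _ → refl })) zero
  distinct : ∀ {x y} → Adj G x y → x ≢ y
  distinct e refl = loopless _ e
  asymmetric : ∀ {x y} → Adj G x y → ¬ Adj G y x
  asymmetric {x} {y} e = PathLike.asymmetric
    (oneOf-pathLike patterns₂-pathLike (io₂ (pair x y) (pair-injective (distinct e))))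
    {zero} {suc zero} e
  pathLike-on : ∀ {x y z} → x ≢ y → x ≢ z → y ≢ z → PathLike (induced G (triple x y z))
  pathLike-on x≢y x≢z y≢z =
    oneOf-pathLike patterns₃-pathLike (io₃ _ (triple-injective x≢y x≢z y≢z))
  out-unique : ∀ {x y z} → Adj G x y → Adj G x z → y ≡ z
  out-unique {x} {y} {z} e f with y ≟ᶠ z
  ... | yes y≡z = y≡z
  ... | no  y≢z = ⊥-elim (y≢z (cong (triple x y z)
        (PathLike.out-unique (pathLike-on (distinct e) (distinct f) y≢z)
          {zero} {suc zero} {suc (suc zero)} e f)))
  in-unique : ∀ {x y z} → Adj G y x → Adj G z x → y ≡ z
  in-unique {x} {y} {z} e f with y ≟ᶠ z
  ... | yes y≡z = y≡z
  ... | no  y≢z = ⊥-elim (y≢z (cong (triple x y z)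
        (PathLike.in-unique (pathLike-on (distinct e ∘ sym) (distinct f ∘ sym) y≢z)
          {zero} {suc zero} {suc (suc zero)} e f)))

IO⇔pathLike : ∀ {G} → IsIOGraph G ⇔ PathLike G
IO⇔pathLike = mk⇔ IO⇒pathLike pathLike⇒IO

least : ∀ {P : ℕ → Set} → Decidable P → ∀ m → ¬ (∀ u → u < m → ¬ P u) →
        ∃ λ t → t < m × P t × (∀ u → u < t → ¬ P u)
least {P} P? m notNowhere
  with i , ¬¬Pi , below ← ¬∀⟶∃¬-smallest m (λ i → ¬ P (toℕ i)) (λ i → ¬? (P? (toℕ i)))
         (λ none → notNowhere λ u u<m → subst (¬_ ∘ P) (toℕ-fromℕ< u<m) (none (fromℕ< u<m)))
  = toℕ i , toℕ<n i , decidable-stable (P? (toℕ i)) ¬¬Pi , earlier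
  where
  earlier : ∀ u → u < toℕ i → ¬ P u
  earlier u u<i = subst (¬_ ∘ P) (trans (toℕ-inject (fromℕ< u<i)) (toℕ-fromℕ< u<i)) (below (fromℕ< u<i))

gap : ∀ {i j} → i < j → ∃ λ d → i + suc d ≡ j
gap {i} i<j with d , eq ← m≤n⇒∃[o]m+o≡n i<j = d , trans (+-suc i d) eq

Image : ∀ {A B : Set} → (A → B) → B → Set
Image f y = ∃ λ i → f i ≡ y

module Walks {G : Digraph} (P : PathLike G) where
  open PathLike P

  V : Set
  V = Fin (size G)

  _⟶_ : V → V → Set
  _⟶_ = Adj G

  adj? : ∀ x y → Dec (x ⟶ y)
  adj? x y = edge G x y ≟ᵇ true

  HasSucc : V → Set
  HasSucc x = ∃ (x ⟶_)

  hasSucc? : Decidable HasSucc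
  hasSucc? x = any? (adj? x)

  -- the successor of x, or x itself if it has none
  next : V → V
  next x with hasSucc? x
  ... | yes (y , _) = y
  ... | no  _       = x

  next-spec : ∀ {x y} → x ⟶ y → next x ≡ y
  next-spec {x} x⟶y with hasSucc? x
  ... | yes (_ , x⟶y′) = out-unique x⟶y′ x⟶y
  ... | no  none       = ⊥-elim (none (_ , x⟶y))

  next-step : ∀ {x} → HasSucc x → x ⟶ next x
  next-step (_ , x⟶y) = subst (_ ⟶_) (sym (next-spec x⟶y)) x⟶y

  next-stays : ∀ {x} → ¬ HasSucc x → next x ≡ x
  next-stays {x} sink with hasSucc? x
  ... | yes s = ⊥-elim (sink s)
  ... | no  _ = refl

  next-cases : ∀ x → (x ⟶ next x) ⊎ (next x ≡ x)
  next-cases x = byDecision (hasSucc? x)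
    where
    byDecision : Dec (HasSucc x) → (x ⟶ next x) ⊎ (next x ≡ x)
    byDecision (yes s)    = inj₁ (next-step s)
    byDecision (no  sink) = inj₂ (next-stays sink)

  walk : V → ℕ → V
  walk x zero    = x
  walk x (suc t) = next (walk x t)

  walk-within : ∀ {U : V → Set} → (∀ {a b} → a ⟶ b → U a → U b) →
                ∀ {x} → U x → ∀ t → U (walk x t)
  walk-within closed Ux zero = Ux
  walk-within {U} closed {x} Ux (suc t) with next-cases (walk x t)
  ... | inj₁ step = closed step (walk-within closed Ux t)
  ... | inj₂ stay = subst U (sym stay) (walk-within closed Ux t)

  Steps : V → ℕ → Set
  Steps x t = ∀ u → u < t → walk x u ⟶ walk x (suc u)

  steps-≤ : ∀ {x t t′} → t ≤ t′ → Steps x t′ → Steps x t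
  steps-≤ t≤t′ steps u u<t = steps u (<-≤-trans u<t t≤t′)

  steps-within : ∀ {U : V → Set} → (∀ {a b} → a ⟶ b → U a → U b) → (∀ {a} → U a → HasSucc a) →
                 ∀ {x} → U x → ∀ t → Steps x t
  steps-within closed succ Ux t u _ = next-step (succ (walk-within closed Ux u))

  -- In-degree at most one lets us cancel a common prefix of two positions of a walk.
  cancel : ∀ {x} i d → Steps x (i + d) → walk x i ≡ walk x (i + d) → x ≡ walk x d
  cancel zero    d _     same = same
  cancel {x} (suc i) d steps same = cancel i d (steps-≤ (n≤1+n (i + d)) steps)
    (in-unique (steps i (s≤s (m≤m+n i d)))
               (subst (walk x (i + d) ⟶_) (sym same) (steps (i + d) (n<1+n (i + d)))))

  repeat⇒return : ∀ {x i j} → i < j → Steps x j → walk x i ≡ walk x j →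
                  ∃ λ d → d < j × walk x (suc d) ≡ x
  repeat⇒return {x} {i} i<j steps same with d , i+d≡j ← gap i<j =
    d , ≤-trans (m≤n+m (suc d) i) (≤-reflexive i+d≡j) ,
    sym (cancel i (suc d) (subst (Steps x) (sym i+d≡j) steps)
                          (trans same (cong (walk x) (sym i+d≡j))))

  -- By the pigeonhole principle, a walk that follows edges for |V| steps returns to its start.
  returns : ∀ {x} → Steps x (size G) → ∃ λ d → d < size G × walk x (suc d) ≡ x
  returns {x} steps
    with i , j , i<j , same ← pigeonhole (n<1+n (size G)) (λ (i : Fin (suc (size G))) → walk x (toℕ i))
    with d , d<j , back ← repeat⇒return i<j (steps-≤ (≤-pred (toℕ<n j)) steps) same
    = d , <-≤-trans d<j (≤-pred (toℕ<n j)) , back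

  returns⇒pred : ∀ {x} → Steps x (size G) → ∃ (_⟶ x)
  returns⇒pred {x} steps with d , d<n , back ← returns steps =
    walk x d , subst (walk x d ⟶_) back (steps d d<n)

  Fresh : V → ℕ → Set
  Fresh x p = ∀ d → d < p → walk x (suc d) ≢ x

  no-repeat : ∀ {x p} → Steps x p → Fresh x p → ∀ {i j} → i < j → j ≤ p → walk x i ≢ walk x j
  no-repeat steps fresh i<j j≤p same with d , d<j , back ← repeat⇒return i<j (steps-≤ j≤p steps) same =
    fresh d (<-≤-trans d<j j≤p) back

  walk-injective : ∀ {x p} → Steps x p → Fresh x p →
                   ∀ {i j} → i ≤ p → j ≤ p → walk x i ≡ walk x j → i ≡ j
  walk-injective steps fresh {i} {j} i≤p j≤p same with <-cmp i j
  ... | tri< i<j _ _ = ⊥-elim (no-repeat steps fresh i<j j≤p same)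
  ... | tri≈ _ i≡j _ = i≡j
  ... | tri> _ _ j<i = ⊥-elim (no-repeat steps fresh j<i i≤p (sym same))

  first-return : ∀ {x} → Steps x (size G) → ∃ λ p → Fresh x p × walk x (suc p) ≡ x
  first-return {x} steps = first (least (λ d → walk x (suc d) ≟ᶠ x) (size G) return-somewhere)
    where
    return-somewhere : ¬ (∀ d → d < size G → walk x (suc d) ≢ x)
    return-somewhere never = let (d , d<n , back) = returns steps in never d d<n back
    first : (∃ λ p → p < size G × walk x (suc p) ≡ x × Fresh x p) →
            ∃ λ p → Fresh x p × walk x (suc p) ≡ x
    first (p , _ , back , earlier) = p , earlier , back

  hasSucc-stable : ∀ {x} → ¬ ¬ HasSucc x → HasSucc x
  hasSucc-stable = decidable-stable (hasSucc? _)

  -- The walk from a source reaches a sink, following edges all the way: otherwise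
  -- it would return to the source, which has no predecessor.
  reaches-sink : ∀ {z} → (∀ {w} → ¬ w ⟶ z) → ∃ λ t → Steps z t × ¬ HasSucc (walk z t)
  reaches-sink {z} source = first-sink (least (λ t → ¬? (hasSucc? (walk z t))) (size G) sink-somewhere)
    where
    sink-somewhere : ¬ (∀ u → u < size G → ¬ ¬ HasSucc (walk z u))
    sink-somewhere noSink =
      source (proj₂ (returns⇒pred λ u u<n → next-step (hasSucc-stable (noSink u u<n))))
    first-sink : (∃ λ t → t < size G × ¬ HasSucc (walk z t) × (∀ u → u < t → ¬ ¬ HasSucc (walk z u))) →
                 ∃ λ t → Steps z t × ¬ HasSucc (walk z t)
    first-sink (t , _ , sink , earlier) =
      t , (λ u u<t → next-step (hasSucc-stable (earlier u u<t))) , sink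

  module Path {x p} (steps : Steps x p) (fresh : Fresh x p) where
    vertex : Fin (suc p) → V
    vertex a = walk x (toℕ a)

    index≤ : (a : Fin (suc p)) → toℕ a ≤ p
    index≤ a = ≤-pred (toℕ<n a)

    vertex-injective : Injective _≡_ _≡_ vertex
    vertex-injective {a} {b} same =
      toℕ-injective (walk-injective steps fresh (index≤ a) (index≤ b) same)

    on-path : ∀ {i} → i ≤ p → Image vertex (walk x i)
    on-path i≤p = fromℕ< (s≤s i≤p) , cong (walk x) (toℕ-fromℕ< (s≤s i≤p))

    step-edge : ∀ {i j} → j ≡ suc i → j ≤ p → walk x i ⟶ walk x j
    step-edge refl j≤p = steps _ j≤p

    forward : ∀ {i j} → i < p → j ≤ p → walk x i ⟶ walk x j → j ≡ suc i
    forward i<p j≤p e = walk-injective steps fresh j≤p i<p (out-unique e (steps _ i<p))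

    successor : ∀ {i y} → i < p → walk x i ⟶ y → Image vertex y
    successor i<p e = subst (Image vertex) (out-unique (steps _ i<p) e) (on-path i<p)

    predecessor : ∀ {i y} → i < p → y ⟶ walk x (suc i) → Image vertex y
    predecessor i<p e = subst (Image vertex) (in-unique (steps _ i<p) e) (on-path (<⇒≤ i<p))

-- H sits inside G as an induced subdigraph that is a union of connected
-- components of G: no edge of G enters or leaves the image.
record ClosedEmbedding (H G : Digraph) : Set where
  field
    embed      : Fin (size H) → Fin (size G)
    injective  : Injective _≡_ _≡_ embed
    preserves  : ∀ i j → edge G (embed i) (embed j) ≡ edge H i j
    out-closed : ∀ i {y} → Adj G (embed i) y → Image embed y
    in-closed  : ∀ i {y} → Adj G y (embed i) → Image embed y

-- Two closed embeddings with disjoint images combine to one of the disjoint union;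
-- closedness makes the edges between the two parts absent, as in A ⊍ B.
closedEmbedding-⊍ : ∀ {A B G} (f : ClosedEmbedding A G) (g : ClosedEmbedding B G) →
                    (∀ i j → ClosedEmbedding.embed f i ≢ ClosedEmbedding.embed g j) →
                    ClosedEmbedding (A ⊍ B) G
closedEmbedding-⊍ {A} {B} {G} f g disjoint = record
  { embed = embed ; injective = injective ; preserves = preserves
  ; out-closed = out-closed ; in-closed = in-closed }
  where
  module f = ClosedEmbedding f
  module g = ClosedEmbedding g
  m n : ℕ
  m = size A
  n = size B
  embed : Fin (m + n) → Fin (size G)
  embed k = [ f.embed , g.embed ]′ (splitAt m k)
  injective : Injective _≡_ _≡_ embed
  injective {k} {l} same with splitAt m k in ek | splitAt m l in el
  ... | inj₁ a | inj₁ b =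
    splitAt-injective m (trans ek (trans (cong inj₁ (f.injective same)) (sym el)))
  ... | inj₂ a | inj₂ b =
    splitAt-injective m (trans ek (trans (cong inj₂ (g.injective same)) (sym el)))
  ... | inj₁ a | inj₂ b = ⊥-elim (disjoint a b same)
  ... | inj₂ a | inj₁ b = ⊥-elim (disjoint b a (sym same))
  preserves : ∀ k l → edge G (embed k) (embed l) ≡ edge (A ⊍ B) k l
  preserves k l with splitAt m k | splitAt m l
  ... | inj₁ a | inj₁ b = f.preserves a b
  ... | inj₂ a | inj₂ b = g.preserves a b
  ... | inj₁ a | inj₂ b = ¬-not λ e → let (a′ , same) = f.out-closed a e in disjoint a′ b same
  ... | inj₂ a | inj₁ b = ¬-not λ e → let (b′ , same) = f.in-closed b e in disjoint b′ a same
  left : ∀ {y} → Image f.embed y → Image embed y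
  left (a , same) = a ↑ˡ n , trans (cong [ f.embed , g.embed ]′ (splitAt-↑ˡ m a n)) same
  right : ∀ {y} → Image g.embed y → Image embed y
  right (b , same) = m ↑ʳ b , trans (cong [ f.embed , g.embed ]′ (splitAt-↑ʳ m n b)) same
  out-closed : ∀ k {y} → Adj G (embed k) y → Image embed y
  out-closed k e with splitAt m k
  ... | inj₁ a = left (f.out-closed a e)
  ... | inj₂ b = right (g.out-closed b e)
  in-closed : ∀ k {y} → Adj G y (embed k) → Image embed y
  in-closed k e with splitAt m k
  ... | inj₁ a = left (f.in-closed a e)
  ... | inj₂ b = right (g.in-closed b e)

onto⇒≅ : ∀ {H G} (f : ClosedEmbedding H G) → (∀ y → Image (ClosedEmbedding.embed f) y) → G ≅ H
onto⇒≅ {H} {G} f onto =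
  mk↔ₛ′ preimage embed (λ i → injective (proj₂ (onto (embed i)))) (proj₂ ∘ onto) , edges
  where
  open ClosedEmbedding f
  preimage : Fin (size G) → Fin (size H)
  preimage = proj₁ ∘ onto
  edges : ∀ x y → edge G x y ≡ edge H (preimage x) (preimage y)
  edges x y = trans (sym (cong₂ (edge G) (proj₂ (onto x)) (proj₂ (onto y))))
                    (preserves (preimage x) (preimage y))

component-nonempty : ∀ c → 1 ≤ size (component c)
component-nonempty (line n 1≤n)   = 1≤n
component-nonempty (circle n 3≤n) = ≤-trans (s≤s z≤n) 3≤n

-- Adding a component consumes at least one unit of fuel.
fuel-bound : ∀ {n a f} c → n < a + suc f → 1 ≤ c → n < (c + a) + f
fuel-bound {n} {a} {f} c n<a+1+f 1≤c = <-≤-trans n<a+1+f (begin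
  a + suc f   ≡⟨ +-suc a f ⟩
  1 + (a + f) ≤⟨ +-monoˡ-≤ (a + f) 1≤c ⟩
  c + (a + f) ≡⟨ sym (+-assoc c a f) ⟩
  (c + a) + f ∎)
  where open ≤-Reasoning

module Decomposition {G : Digraph} (P : PathLike G) where
  open PathLike P
  open Walks P
  module Reverse = Walks (pathLike-reverse P)

  record ComponentIn (U : V → Set) : Set where
    field
      shape  : Component
      copy   : ClosedEmbedding (component shape) G
      inside : ∀ i → U (ClosedEmbedding.embed copy i)

  lineEmbedding : ∀ {z t} → (∀ {w} → ¬ w ⟶ z) → Steps z t → ¬ HasSucc (walk z t) →
                  ClosedEmbedding (Ig (suc t)) G
  lineEmbedding {z} {t} source steps sink = record
    { embed = vertex ; injective = vertex-injective ; preserves = preserves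
    ; out-closed = out-closed ; in-closed = in-closed }
    where
    fresh : Fresh z t
    fresh d d<t back = source (subst (walk z d ⟶_) back (steps d d<t))
    open Path steps fresh
    no-exit : ∀ {a y} → toℕ a ≡ t → ¬ vertex a ⟶ y
    no-exit a≡t e = sink (_ , subst (λ i → walk z i ⟶ _) a≡t e)
    line-adj : ∀ a b → vertex a ⟶ vertex b ⇔ toℕ b ≡ suc (toℕ a)
    line-adj a b = mk⇔ to (λ b≡a+1 → step-edge b≡a+1 (index≤ b))
      where
      to : vertex a ⟶ vertex b → toℕ b ≡ suc (toℕ a)
      to e with m≤n⇒m<n∨m≡n (index≤ a)
      ... | inj₁ a<t = forward a<t (index≤ b) e
      ... | inj₂ a≡t = ⊥-elim (no-exit a≡t e)
    preserves : ∀ a b → edge G (vertex a) (vertex b) ≡ edge (Ig (suc t)) a b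
    preserves a b = ⇔→≡ (⇔-sym (Ig-adj {suc t} {a} {b}) ⇔-∘ line-adj a b)
    out-closed : ∀ a {y} → vertex a ⟶ y → Image vertex y
    out-closed a e with m≤n⇒m<n∨m≡n (index≤ a)
    ... | inj₁ a<t = successor a<t e
    ... | inj₂ a≡t = ⊥-elim (no-exit a≡t e)
    in-closed : ∀ a {y} → y ⟶ vertex a → Image vertex y
    in-closed a e with toℕ a | index≤ a
    ... | zero  | _   = ⊥-elim (source e)
    ... | suc i | i<t = predecessor i<t e

  cycleEmbedding : ∀ {x p} → Steps x (suc p) → Fresh x p → walk x (suc p) ≡ x →
                   ClosedEmbedding (Og (suc p)) G
  cycleEmbedding {x} {p} steps fresh back = record
    { embed = vertex ; injective = vertex-injective ; preserves = preserves
    ; out-closed = out-closed ; in-closed = in-closed }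
    where
    open Path (steps-≤ (n≤1+n p) steps) fresh
    closing : walk x p ⟶ x
    closing = subst (walk x p ⟶_) back (steps p (n<1+n p))
    wraps : ∀ {a y} → toℕ a ≡ p → vertex a ⟶ y → y ≡ x
    wraps a≡p e = out-unique (subst (λ i → walk x i ⟶ _) a≡p e) closing
    cycle-adj : ∀ a b → vertex a ⟶ vertex b ⇔ CircleStep (suc p) (toℕ a) (toℕ b)
    cycle-adj a b = mk⇔ to from
      where
      to : vertex a ⟶ vertex b → CircleStep (suc p) (toℕ a) (toℕ b)
      to e with m≤n⇒m<n∨m≡n (index≤ a)
      ... | inj₁ a<p = inj₁ (forward a<p (index≤ b) e)
      ... | inj₂ a≡p = inj₂ (a≡p , walk-injective (steps-≤ (n≤1+n p) steps) fresh (index≤ b) z≤n (wraps a≡p e))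
      from : CircleStep (suc p) (toℕ a) (toℕ b) → vertex a ⟶ vertex b
      from (inj₁ b≡a+1)        = step-edge b≡a+1 (index≤ b)
      from (inj₂ (a≡p , b≡0)) = subst₂ (λ i j → walk x i ⟶ walk x j) (sym a≡p) (sym b≡0) closing
    preserves : ∀ a b → edge G (vertex a) (vertex b) ≡ edge (Og (suc p)) a b
    preserves a b = ⇔→≡ (⇔-sym (Og-adj {suc p} {a} {b}) ⇔-∘ cycle-adj a b)
    out-closed : ∀ a {y} → vertex a ⟶ y → Image vertex y
    out-closed a e with m≤n⇒m<n∨m≡n (index≤ a)
    ... | inj₁ a<p = successor a<p e
    ... | inj₂ a≡p = zero , sym (wraps a≡p e)
    in-closed : ∀ a {y} → y ⟶ vertex a → Image vertex y
    in-closed a e with toℕ a | index≤ a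
    ... | zero  | _   = subst (Image vertex) (sym (in-unique e closing)) (on-path ≤-refl)
    ... | suc i | i<p = predecessor i<p e

  -- Without loops and 2-cycles a circle has at least three vertices.
  circle-size : ∀ {x p} → Steps x (suc p) → walk x (suc p) ≡ x → 3 ≤ suc p
  circle-size {x} {zero} steps back = ⊥-elim (loopless x (subst (x ⟶_) back (steps 0 z<s)))
  circle-size {x} {suc zero} steps back =
    ⊥-elim (asymmetric (steps 0 z<s) (subst (walk x 1 ⟶_) back (steps 1 (s<s z<s))))
  circle-size {x} {suc (suc p)} _ _ = s≤s (s≤s (s≤s z≤n))

  module _ {U : V → Set} (forward-closed : ∀ {a b} → a ⟶ b → U a → U b) where
    line-in : ∀ {z} → U z → (∀ {w} → ¬ w ⟶ z) → ComponentIn U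
    line-in {z} Uz source = let (t , steps , sink) = reaches-sink source in record
      { shape  = line (suc t) (s≤s z≤n)
      ; copy   = lineEmbedding source steps sink
      ; inside = λ a → walk-within forward-closed Uz (toℕ a) }

    cycle-in : (∀ {a} → U a → HasSucc a) → ∀ {x} → U x → ComponentIn U
    cycle-in succ {x} Ux = let (p , fresh , back) = first-return (steps (size G)) in record
      { shape  = circle (suc p) (circle-size (steps (suc p)) back)
      ; copy   = cycleEmbedding (steps (suc p)) fresh back
      ; inside = λ a → walk-within forward-closed Ux (toℕ a) }
      where
      steps : ∀ t → Steps x t
      steps = steps-within forward-closed succ Ux

  -- Every nonempty decidable set of vertices closed under edges in both
  -- directions contains a line or a circle: a line if it contains a source,
  -- otherwise a circle, since then every vertex also has a successor
  -- (walking backwards, by the same argument, returns to it).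
  component-in : ∀ {U : V → Set} → Decidable U →
                 (∀ {a b} → a ⟶ b → U a → U b) → (∀ {a b} → a ⟶ b → U b → U a) →
                 ∀ {x} → U x → ComponentIn U
  component-in {U} U? forward-closed backward-closed {x} Ux
    with any? (λ z → U? z ×-dec all? (λ w → ¬? (adj? w z)))
  ... | yes (z , Uz , source) = line-in forward-closed Uz (source _)
  ... | no  noSource          = cycle-in forward-closed succ Ux
    where
    pred : ∀ {a} → U a → ∃ (_⟶ a)
    pred {a} Ua with any? (λ w → adj? w a)
    ... | yes w⟶a = w⟶a
    ... | no  none = ⊥-elim (noSource (a , Ua , λ w e → none (w , e)))
    succ : ∀ {a} → U a → HasSucc a
    succ Ua = Reverse.returns⇒pred (Reverse.steps-within backward-closed pred Ua (size G))

  -- The vertices outside the image of a closed embedding form a set closed under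
  -- edges in both directions, so the next component can be found among them.
  module Uncovered {H} (copy : ClosedEmbedding H G) where
    open ClosedEmbedding copy

    covered? : Decidable (Image embed)
    covered? y = any? (λ i → embed i ≟ᶠ y)

    Uncovered : V → Set
    Uncovered y = ¬ Image embed y

    uncovered? : Decidable Uncovered
    uncovered? y = ¬? (covered? y)

    forward-closed : ∀ {a b} → a ⟶ b → Uncovered a → Uncovered b
    forward-closed a⟶b a∉ (j , eq) = a∉ (in-closed j (subst (_ ⟶_) (sym eq) a⟶b))

    backward-closed : ∀ {a b} → a ⟶ b → Uncovered b → Uncovered a
    backward-closed a⟶b b∉ (j , eq) = b∉ (out-closed j (subst (_⟶ _) (sym eq) a⟶b))

    next-component : ∀ {y} → Uncovered y → ComponentIn Uncovered
    next-component = component-in uncovered? forward-closed backward-closed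

  -- Grow a union of components embedded in G, one component at a time, until it
  -- covers G.  The fuel bounds the number of vertices still to be covered.
  decompose : ∀ fuel c cs → ClosedEmbedding (⋃ c cs) G → size G < size (⋃ c cs) + fuel →
              IsLinesAndCircles G
  decompose zero c cs copy over = ⊥-elim (<⇒≱ (subst (size G <_) (+-identityʳ _) over)
                                               (injective⇒≤ (ClosedEmbedding.injective copy)))
  decompose (suc fuel) c cs copy over with all? (Uncovered.covered? copy)
  ... | yes onto    = c , cs , onto⇒≅ copy onto
  ... | no  notOnto =
    let (y , y∉) = ¬∀⟶∃¬ _ _ covered? notOnto
        new = next-component y∉
    in decompose fuel (shape new) (c ∷ cs)
         (closedEmbedding-⊍ (ComponentIn.copy new) copy λ i j eq → inside new i (j , sym eq))
         (fuel-bound (size (component (shape new))) over (component-nonempty (shape new)))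
    where
    open Uncovered copy
    open ComponentIn using (shape; inside)

  -- The first component can be taken anywhere, since all of G is closed under edges.
  pathLike⇒linesAndCircles : 1 ≤ size G → IsLinesAndCircles G
  pathLike⇒linesAndCircles 1≤n =
    let first = component-in {U = λ _ → ⊤} (λ _ → yes tt) (λ _ _ → tt) (λ _ _ → tt) {fromℕ< 1≤n} tt
    in decompose (size G) (shape first) [] (ComponentIn.copy first)
                 (m<n+m (size G) (component-nonempty (shape first)))
    where open ComponentIn using (shape)

pathLike⇔linesAndCircles : ∀ {G} → 1 ≤ size G → PathLike G ⇔ IsLinesAndCircles G
pathLike⇔linesAndCircles 1≤n =
  mk⇔ (λ P → Decomposition.pathLike⇒linesAndCircles P 1≤n) linesAndCircles⇒pathLike

lemma2 : (G : Digraph) → 1 ≤ size G → IsIOGraph G ⇔ IsLinesAndCircles G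
lemma2 G 1≤n = pathLike⇔linesAndCircles 1≤n ⇔-∘ IO⇔pathLike
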